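{- Let $m,n_1,n_2\in\mathbb N$ with $m\ge 4$ even. Then the graph $C_{m,(n_1,n_2)}$ admits a uniformly ordered labeling.
   Context: $\mathbb N=\{0,1,2,\dots\}$; for integers $a\le b$, $[a,b]=\{x\in\mathbb N: a\le x\le b\}$. For $m\ge3$ and $n_1,n_2\ge 0$, $C_{m,(n_1,n_2)}$ is the connected graph with $m+n_1+n_2$ vertices and $m+n_1+n_2$ edges consisting of a cycle $C_m$ and two paths $P_{n_1+1}$, $P_{n_2+1}$ ($P_{k}$ has $k$ vertices), where the cycle and the two paths all share exactly one common vertex (the root), which is an end vertex of each path, and no other vertices are shared. For a graph $G=(V,E)$ with $|E|=m'$ and $t\in\mathbb N$, a labeling is an injective map $f\colon V\to[0,t]$; it induces $\tilde f(\{u,v\})=|f(u)-f(v)|$. $f$ is a $\overline{\rho}$-labeling if (a) $t\ge 2m'$, (b) $\tilde f$ is injective, (c) there is no $i\in\{1,\dots,m'\}$ with both $i$ and $t+1-i$ in $\operatorname{Im}\tilde f$. If $G$ is bipartite with vertex bipartition $\{A,B\}$, an $(A,B,t)$-uniformly ordered labeling is a $\overline{\rho}$-labeling $f\colon V\to[0,t]$ for which there is $\lambda\in\mathbb N$ with $f(a)\le\lambda$ for all $a\in A$ and $f(b)>\lambda$ for all $b\in B$. A uniformly ordered labeling of a bipartite graph $G$ with $m'$ edges is a labeling $f\colon V\to[0,2m']$ that is $(A,B,2m')$-uniformly ordered for some vertex bipartition $\{A,B\}$ of $G$. -}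

module Defs where

open import Data.Nat using (ℕ; zero; suc; _+_; _*_; _∸_; _≤_; _<_)
open import Data.Bool using (Bool; true; false)
open import Data.Product using (_×_; _,_; Σ; ∃-syntax)
open import Data.List using (List; []; _∷_; _++_; length; map)
open import Data.List.Membership.Propositional using (_∈_)
open import Data.List.Relation.Unary.Unique.Propositional using (Unique)
open import Relation.Binary.PropositionalEquality using (_≡_; _≢_)
open import Relation.Nullary using (¬_)

-- A finite graph: vertex set {0, …, nV - 1} (as naturals), and an edge list;
-- each edge {u,v} is listed exactly once as a pair (u , v).
record Graph : Set where
  field
    nV    : ℕ
    edges : List (ℕ × ℕ)
open Graph public

dist : ℕ → ℕ → ℕ
dist x y = (x ∸ y) + (y ∸ x)

pathEdges : ℕ → ℕ → ℕ → List (ℕ × ℕ)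
pathEdges r s zero    = []
pathEdges r s (suc k) = (r , s) ∷ pathEdges s (suc s) k

-- C_{m,(n1,n2)}: vertices 0..m-1 form the cycle (0 is the root),
-- m..m+n1-1 the first pendant path, m+n1..m+n1+n2-1 the second one.
Cmn : ℕ → ℕ → ℕ → Graph
Cmn m n₁ n₂ = record
  { nV    = m + n₁ + n₂
  ; edges = (pathEdges 0 1 (m ∸ 1) ++ ((m ∸ 1 , 0) ∷ []))
            ++ pathEdges 0 m n₁ ++ pathEdges 0 (m + n₁) n₂
  }

edgeLabels : Graph → (ℕ → ℕ) → List ℕ
edgeLabels G f = map (λ e → dist (f (Data.Product.proj₁ e)) (f (Data.Product.proj₂ e))) (edges G)

IsLabeling : Graph → ℕ → (ℕ → ℕ) → Set
IsLabeling G t f =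
  (∀ v → v < nV G → f v ≤ t) ×
  (∀ u v → u < nV G → v < nV G → f u ≡ f v → u ≡ v)

IsRhoBar : Graph → ℕ → (ℕ → ℕ) → Set
IsRhoBar G t f =
  IsLabeling G t f ×
  (2 * length (edges G) ≤ t) ×
  Unique (edgeLabels G f) ×
  (∀ i → 1 ≤ i → i ≤ length (edges G) →
     ¬ (i ∈ edgeLabels G f × (suc t ∸ i) ∈ edgeLabels G f))

-- a vertex bipartition {A,B}: side v = true means v ∈ A, false means v ∈ B;
-- every edge joins A and B.
IsBipartition : Graph → (ℕ → Bool) → Set
IsBipartition G side =
  ∀ u v → (u , v) ∈ edges G → side u ≢ side v

IsUniformlyOrdered : Graph → (ℕ → Bool) → ℕ → (ℕ → ℕ) → Set
IsUniformlyOrdered G side t f =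
  IsRhoBar G t f ×
  ∃[ λ₀ ] (∀ v → v < nV G →
             (side v ≡ true → f v ≤ λ₀) × (side v ≡ false → λ₀ < f v))

AdmitsUOL : Graph → Set
AdmitsUOL G =
  ∃[ f ] ∃[ side ] (IsBipartition G side ×
                    IsUniformlyOrdered G side (2 * length (edges G)) f)

{-# OPTIONS --safe #-}
module Submission where

open import Defs
open import Data.Bool using (Bool; true; false; not; if_then_else_)
open import Data.Bool.Properties using (not-¬; not-involutive)
open import Data.Empty using (⊥-elim)
open import Data.List using (List; []; _∷_; _++_; length; map; iterate)
open import Data.List.Properties using (map-++; map-∘; map-cong; map-cong-local; length-++; ++-assoc; ++-identityʳ)
open import Data.List.Membership.Propositional using (_∈_; _∉_)
open import Data.List.Membership.Propositional.Properties using (∈-map⁺; ∈-map⁻; ∈-++⁻)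
open import Data.List.Relation.Unary.All as All using (All; []; _∷_)
open import Data.List.Relation.Unary.Any using (here; there)
open import Data.List.Relation.Unary.AllPairs using ([]; _∷_)
open import Data.List.Relation.Unary.Unique.Propositional using (Unique)
import Data.List.Relation.Unary.Unique.Propositional.Properties as Unique
open import Data.Nat
open import Data.Nat.Properties
open import Data.Nat.Divisibility using (_∣_; divides)
open import Data.Nat.Tactic.RingSolver using (solve-∀)
open import Data.Product using (_×_; _,_; proj₁; proj₂; Σ-syntax; map₂)
open import Data.Sum using (_⊎_; inj₁; inj₂)
open import Function using (_∘_)
open import Relation.Binary using (tri<; tri≈; tri>)
open import Relation.Binary.PropositionalEquality
open import Relation.Nullary using (¬_; does; yes; no)
open import Relation.Nullary.Decidable using (dec-true; dec-false)

-- With t = 2M, M the number of edges, conditions (b) and (c) of a ρ̄-labelling say exactly that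
-- the edge labels stay distinct after folding x ∈ [1, 2M] to min (x, 2M + 1 - x), i.e. that the
-- folded labels are a permutation of [1, M].  Such labellings grow one pendant vertex at a time:
-- moving the low side of the cut up by a ∈ {0, 1} and the high side up by a + 1 raises every edge
-- label, hence every folded label, by one, and frees the label just above the low side together
-- with 2M + 2 (a = 0) or 0 (a = 1); the new edge then gets a label folding to 1.  Attaching to a
-- vertex next to the cut leaves the new vertex next to the cut, and attaching to a vertex with an
-- extreme label leaves the new vertex extreme and keeps a chosen vertex next to the cut, so the
-- first path grows from an extreme pendant vertex while the root stays next to the cut, and then
-- the second path grows from the root.
-- The bases are C_m, m = 2K + 2, and C_m with one pendant vertex labelled 2M.  The even vertices 2i
-- get a + K - i and the odd ones a + K + 1 + i + d i for a step function d, so the path edges j get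
-- the increasing labels j + 1 + d ⌊j/2⌋; d is chosen by the parity of K so that its jumps leave out
-- exactly the folded labels of the closing edge and of the pendant edge.

-- Folded labels

fold : ℕ → ℕ → ℕ
fold M x = if does (x ≤? M) then x else suc (2 * M) ∸ x

fold-≤ : ∀ {M x} → x ≤ M → fold M x ≡ x
fold-≤ {M} {x} x≤M rewrite dec-true (x ≤? M) x≤M = refl

fold-> : ∀ {M x} → M < x → fold M x ≡ suc (2 * M) ∸ x
fold-> {M} {x} M<x rewrite dec-false (x ≤? M) (<⇒≱ M<x) = refl

fold-one : ∀ M → fold (suc M) 1 ≡ 1
fold-one M = fold-≤ {suc M} (s≤s z≤n)

fold-suc-self : ∀ M → fold M (suc M) ≡ M
fold-suc-self M = trans (fold-> (n<1+n M)) (trans (m+n∸m≡n M (M + 0)) (+-identityʳ M))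

fold-top : ∀ M → fold (suc M) (suc (suc (2 * M))) ≡ 1
fold-top M = begin
  fold (suc M) (suc (suc (2 * M)))  ≡⟨ cong (fold (suc M)) (*-suc 2 M) ⟨
  fold (suc M) (2 * suc M)          ≡⟨ fold-> (m<m+n (suc M) z<s) ⟩
  suc (2 * suc M) ∸ 2 * suc M       ≡⟨ m+n∸n≡m 1 (2 * suc M) ⟩
  1                                 ∎
  where open ≡-Reasoning

mirror-> : ∀ {M i} → i ≤ M → M < suc (2 * M) ∸ i
mirror-> {M} i≤M = m+n≤o⇒m≤o∸n (suc M) (s≤s (+-monoʳ-≤ M (≤-trans i≤M (m≤m+n M 0))))

fold-mirror : ∀ {M i} → i ≤ M → fold M (suc (2 * M) ∸ i) ≡ i
fold-mirror {M} i≤M = trans (fold-> (mirror-> i≤M)) (m∸[m∸n]≡n (m≤n⇒m≤1+n (≤-trans i≤M (m≤m+n M (M + 0)))))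

fold-positive : ∀ {M x} → 1 ≤ x → x ≤ 2 * M → 1 ≤ fold M x
fold-positive {M} {x} 1≤x x≤2M with x ≤? M
... | yes x≤M = subst (1 ≤_) (sym (fold-≤ x≤M)) 1≤x
... | no  x≰M = subst (1 ≤_) (sym (fold-> (≰⇒> x≰M))) (m<n⇒0<n∸m (s≤s x≤2M))

fold-suc : ∀ {M x} → x ≤ 2 * M → fold (suc M) (suc x) ≡ suc (fold M x)
fold-suc {M} {x} x≤2M with x ≤? M
... | yes x≤M = trans (fold-≤ (s≤s x≤M)) (cong suc (sym (fold-≤ x≤M)))
... | no  x≰M = begin
  fold (suc M) (suc x)        ≡⟨ fold-> (s≤s (≰⇒> x≰M)) ⟩
  suc (2 * suc M) ∸ suc x     ≡⟨ cong (_∸ x) (*-suc 2 M) ⟩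
  suc (suc (2 * M)) ∸ x       ≡⟨ +-∸-assoc 1 (m≤n⇒m≤1+n x≤2M) ⟩
  suc (suc (2 * M) ∸ x)       ≡⟨ cong suc (fold-> (≰⇒> x≰M)) ⟨
  suc (fold M x)              ∎
  where open ≡-Reasoning

fold-pendant : ∀ {M y} → y < M → fold M ∣ y - 2 * M ∣ ≡ suc y
fold-pendant {M} y<M =
  trans (cong (fold M) (m≤n⇒∣m-n∣≡n∸m (≤-trans (<⇒≤ y<M) (m≤m+n M (M + 0))))) (fold-mirror y<M)

unique-map-injective : ∀ {A B : Set} {g : A → B} {xs x y} →
                       Unique (map g xs) → x ∈ xs → y ∈ xs → g x ≡ g y → x ≡ y
unique-map-injective         _         (here refl) (here refl) _  = refl
unique-map-injective {g = g} (g≢ ∷ _)  (here refl) (there y∈)  eq = ⊥-elim (All.lookup g≢ (∈-map⁺ g y∈) eq)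
unique-map-injective {g = g} (g≢ ∷ _)  (there x∈)  (here refl) eq = ⊥-elim (All.lookup g≢ (∈-map⁺ g x∈) (sym eq))
unique-map-injective         (_ ∷ u)   (there x∈)  (there y∈)  eq = unique-map-injective u x∈ y∈ eq

no-mirror-pair : ∀ {M L} → Unique (map (fold M) L) → ∀ {i} → i ≤ M → ¬ (i ∈ L × suc (2 * M) ∸ i ∈ L)
no-mirror-pair u i≤M (i∈ , j∈) =
  <⇒≢ (≤-<-trans i≤M (mirror-> i≤M)) (unique-map-injective u i∈ j∈ (trans (fold-≤ i≤M) (sym (fold-mirror i≤M))))

-- Uniformly ordered labellings

∣x-suc[y]∣ : ∀ {x y} → x ≤ y → ∣ x - suc y ∣ ≡ suc ∣ x - y ∣
∣x-suc[y]∣ {x} {y} x≤y = begin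
  ∣ x - suc y ∣  ≡⟨ m≤n⇒∣m-n∣≡n∸m (m≤n⇒m≤1+n x≤y) ⟩
  suc y ∸ x      ≡⟨ +-∸-assoc 1 x≤y ⟩
  suc (y ∸ x)    ≡⟨ cong suc (m≤n⇒∣m-n∣≡n∸m x≤y) ⟨
  suc ∣ x - y ∣  ∎
  where open ≡-Reasoning

∣m+n-m∣≡n : ∀ m n → ∣ m + n - m ∣ ≡ n
∣m+n-m∣≡n m n = trans (∣-∣-comm (m + n) m) (∣m-m+n∣≡n m n)

∣n-1+n∣≡1 : ∀ n → ∣ n - suc n ∣ ≡ 1
∣n-1+n∣≡1 zero    = refl
∣n-1+n∣≡1 (suc n) = ∣n-1+n∣≡1 n

∣1+n-n∣≡1 : ∀ n → ∣ suc n - n ∣ ≡ 1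
∣1+n-n∣≡1 zero    = refl
∣1+n-n∣≡1 (suc n) = ∣1+n-n∣≡1 n

dist≡∣-∣ : ∀ x y → dist x y ≡ ∣ x - y ∣
dist≡∣-∣ zero    zero    = refl
dist≡∣-∣ zero    (suc y) = refl
dist≡∣-∣ (suc x) zero    = +-identityʳ (suc x)
dist≡∣-∣ (suc x) (suc y) = dist≡∣-∣ x y

size : Graph → ℕ
size G = length (edges G)

edgeLabel : (ℕ → ℕ) → ℕ × ℕ → ℕ
edgeLabel f (u , v) = ∣ f u - f v ∣

edgeLabels≡ : ∀ G f → edgeLabels G f ≡ map (edgeLabel f) (edges G)
edgeLabels≡ G f = map-cong (λ (u , v) → dist≡∣-∣ (f u) (f v)) (edges G)

_[_≔_] : {A : Set} → (ℕ → A) → ℕ → A → ℕ → A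
(g [ n ≔ z ]) v = if does (v ≟ n) then z else g v

≔-new : ∀ {A : Set} (g : ℕ → A) n z → (g [ n ≔ z ]) n ≡ z
≔-new g n z rewrite dec-true (n ≟ n) refl = refl

≔-old : ∀ {A : Set} (g : ℕ → A) {n v} z → v < n → (g [ n ≔ z ]) v ≡ g v
≔-old g {n} {v} z v<n rewrite dec-false (v ≟ n) (<⇒≢ v<n) = refl

OnSide : ℕ → Bool → ℕ → Set
OnSide cut true  x = x ≤ cut
OnSide cut false x = cut < x

OnSide-unique : ∀ {cut b c x} → OnSide cut b x → OnSide cut c x → b ≡ c
OnSide-unique {b = true}  {true}  _   _   = refl
OnSide-unique {b = true}  {false} x≤c c<x = ⊥-elim (<⇒≱ c<x x≤c)
OnSide-unique {b = false} {true}  c<x x≤c = ⊥-elim (<⇒≱ c<x x≤c)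
OnSide-unique {b = false} {false} _   _   = refl

record IsOrderedLabelling (G : Graph) (f : ℕ → ℕ) (side : ℕ → Bool) (cut t : ℕ) : Set where
  field
    edges-valid : ∀ {u v} → (u , v) ∈ edges G → u < nV G × v < nV G
    bounded     : ∀ {v} → v < nV G → f v ≤ t
    injective   : ∀ {u v} → u < nV G → v < nV G → f u ≡ f v → u ≡ v
    bipartite   : IsBipartition G side
    separated   : ∀ {v} → v < nV G → OnSide cut (side v) (f v)

  edgeLabel-bounded : ∀ {e} → e ∈ edges G → edgeLabel f e ≤ t
  edgeLabel-bounded {u , v} e∈ with edges-valid e∈
  ... | u< , v< = ≤-trans (∣m-n∣≤m⊔n (f u) (f v)) (⊔-lub (bounded u<) (bounded v<))

  edgeLabel-positive : ∀ {e} → e ∈ edges G → 1 ≤ edgeLabel f e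
  edgeLabel-positive {u , v} e∈ with edges-valid e∈
  ... | u< , v< = n≢0⇒n>0 λ eq → bipartite u v e∈ (cong side (injective u< v< (∣m-n∣≡0⇒m≡n eq)))

  edgeLabel-≔ : ∀ g z {e} → e ∈ edges G → edgeLabel (g [ nV G ≔ z ]) e ≡ edgeLabel g e
  edgeLabel-≔ g z {u , v} e∈ with edges-valid e∈
  ... | u< , v< = cong₂ ∣_-_∣ (≔-old g z u<) (≔-old g z v<)

record UOL (G : Graph) : Set where
  field
    label              : ℕ → ℕ
    side               : ℕ → Bool
    cut                : ℕ
    isOrderedLabelling : IsOrderedLabelling G label side cut (2 * size G)
    folds-unique       : Unique (map (fold (size G) ∘ edgeLabel label) (edges G))

  open IsOrderedLabelling isOrderedLabelling public

  folds-positive : ∀ {x} → x ∈ map (fold (size G) ∘ edgeLabel label) (edges G) → 1 ≤ x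
  folds-positive x∈ with ∈-map⁻ (fold (size G) ∘ edgeLabel label) x∈
  ... | e , e∈ , refl = fold-positive (edgeLabel-positive e∈) (edgeLabel-bounded e∈)

UOL⇒AdmitsUOL : ∀ {G} → UOL G → AdmitsUOL G
UOL⇒AdmitsUOL {G} L =
  label , side , bipartite ,
  (((λ _ → bounded) , (λ _ _ → injective)) , ≤-refl , Unique.map⁻ folds-unique′ , no-pair) ,
  cut , ordered
  where
  open UOL L
  folds-unique′ : Unique (map (fold (size G)) (edgeLabels G label))
  folds-unique′ = subst (Unique ∘ map (fold (size G))) (sym (edgeLabels≡ G label))
                    (subst Unique (map-∘ (edges G)) folds-unique)
  no-pair : ∀ i → 1 ≤ i → i ≤ size G →
            ¬ (i ∈ edgeLabels G label × suc (2 * size G) ∸ i ∈ edgeLabels G label)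
  no-pair i _ = no-mirror-pair folds-unique′
  ordered : ∀ v → v < nV G → (side v ≡ true → label v ≤ cut) × (side v ≡ false → cut < label v)
  ordered v v< with side v | separated v<
  ... | true  | below = (λ _ → below) , λ ()
  ... | false | above = (λ ()) , λ _ → above

outermost : Bool → ℕ → ℕ
outermost true  t = 0
outermost false t = t

raiseIfHigh : Bool → ℕ → ℕ
raiseIfHigh true  x = x
raiseIfHigh false x = suc x

AtCut : ∀ {G} → UOL G → ℕ → Set
AtCut L w = UOL.label L w ≡ raiseIfHigh (UOL.side L w) (UOL.cut L)

AtEnd : ∀ {G} → UOL G → ℕ → Set
AtEnd {G} L w = UOL.label L w ≡ outermost (UOL.side L w) (2 * size G)

-- Attaching a pendant vertex

raiseIfHigh-≥ : ∀ b x → x ≤ raiseIfHigh b x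
raiseIfHigh-≥ true  x = ≤-refl
raiseIfHigh-≥ false x = n≤1+n x

raiseIfHigh-≤ : ∀ b x → raiseIfHigh b x ≤ suc x
raiseIfHigh-≤ true  x = n≤1+n x
raiseIfHigh-≤ false x = ≤-refl

raiseIfHigh-suc≢0 : ∀ b x → raiseIfHigh b (suc x) ≢ 0
raiseIfHigh-suc≢0 true  x ()
raiseIfHigh-suc≢0 false x ()

raiseIfHigh-injective : ∀ {a b c x y} → b ≡ c → raiseIfHigh b (a + x) ≡ raiseIfHigh c (a + y) → x ≡ y
raiseIfHigh-injective {a} {true}  refl eq = +-cancelˡ-≡ a _ _ eq
raiseIfHigh-injective {a} {false} refl eq = +-cancelˡ-≡ a _ _ (suc-injective eq)

raiseIfHigh-onSide : ∀ {cut cut′ a b x} → a + cut ≤ cut′ → cut′ ≤ suc (a + cut) →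
                     OnSide cut b x → OnSide cut′ b (raiseIfHigh b (a + x))
raiseIfHigh-onSide {b = true}            lo hi x≤cut = ≤-trans (+-monoʳ-≤ _ x≤cut) lo
raiseIfHigh-onSide {a = a} {b = false} lo hi cut<x =
  s≤s (≤-trans hi (≤-trans (≤-reflexive (sym (+-suc a _))) (+-monoʳ-≤ a cut<x)))

∣a+x-suc[a+y]∣ : ∀ a {x y} → x ≤ y → ∣ a + x - suc (a + y) ∣ ≡ suc ∣ x - y ∣
∣a+x-suc[a+y]∣ a {x} {y} x≤y = begin
  ∣ a + x - suc (a + y) ∣  ≡⟨ cong (∣ a + x -_∣) (+-suc a y) ⟨
  ∣ a + x - a + suc y ∣    ≡⟨ ∣m+n-m+o∣≡∣n-o∣ a x (suc y) ⟩
  ∣ x - suc y ∣            ≡⟨ ∣x-suc[y]∣ x≤y ⟩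
  suc ∣ x - y ∣            ∎
  where open ≡-Reasoning

raiseIfHigh-edge : ∀ {cut a b c x y} → OnSide cut b x → OnSide cut c y → b ≢ c →
                   ∣ raiseIfHigh b (a + x) - raiseIfHigh c (a + y) ∣ ≡ suc ∣ x - y ∣
raiseIfHigh-edge {a = a} {true}  {false} x≤cut cut<y _ = ∣a+x-suc[a+y]∣ a (<⇒≤ (≤-<-trans x≤cut cut<y))
raiseIfHigh-edge {a = a} {false} {true} {x} {y} cut<x y≤cut _ = begin
  ∣ suc (a + x) - a + y ∣  ≡⟨ ∣-∣-comm (suc (a + x)) (a + y) ⟩
  ∣ a + y - suc (a + x) ∣  ≡⟨ ∣a+x-suc[a+y]∣ a (<⇒≤ (≤-<-trans y≤cut cut<x)) ⟩
  suc ∣ y - x ∣            ≡⟨ cong suc (∣-∣-comm y x) ⟩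
  suc ∣ x - y ∣            ∎
  where open ≡-Reasoning
raiseIfHigh-edge {b = true}  {true}  _ _ b≢c = ⊥-elim (b≢c refl)
raiseIfHigh-edge {b = false} {false} _ _ b≢c = ⊥-elim (b≢c refl)

attach : Graph → ℕ → Graph
attach G w = record { nV = suc (nV G) ; edges = edges G ++ (w , nV G) ∷ [] }

size-attach : ∀ G w → size (attach G w) ≡ suc (size G)
size-attach G w = trans (length-++ (edges G)) (+-comm (size G) 1)

2*size-attach : ∀ G w → 2 * size (attach G w) ≡ suc (suc (2 * size G))
2*size-attach G w = trans (cong (2 *_) (size-attach G w)) (*-suc 2 (size G))

attach-ordered : ∀ {G f side cut t w z} → IsOrderedLabelling G f side cut t → w < nV G →
                 z ≤ t → OnSide cut (not (side w)) z → (∀ {v} → v < nV G → f v ≢ z) →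
                 IsOrderedLabelling (attach G w) (f [ nV G ≔ z ]) (side [ nV G ≔ not (side w) ]) cut t
attach-ordered {G} {f} {side} {cut} {t} {w} {z} O w< z≤t z-side z-new = record
  { edges-valid = edges-valid′
  ; bounded     = bounded′
  ; injective   = injective′
  ; bipartite   = bipartite′
  ; separated   = separated′
  }
  where
  open IsOrderedLabelling O
  n = nV G
  edges-valid′ : ∀ {u v} → (u , v) ∈ edges (attach G w) → u < suc n × v < suc n
  edges-valid′ e∈ with ∈-++⁻ (edges G) e∈
  ... | inj₁ old with edges-valid old
  ...   | u< , v< = m<n⇒m<1+n u< , m<n⇒m<1+n v<
  edges-valid′ e∈ | inj₂ (here refl) = m<n⇒m<1+n w< , n<1+n n
  bounded′ : ∀ {v} → v < suc n → (f [ n ≔ z ]) v ≤ t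
  bounded′ v< with m<1+n⇒m<n∨m≡n v<
  ... | inj₁ v<n  = subst (_≤ t) (sym (≔-old f z v<n)) (bounded v<n)
  ... | inj₂ refl = subst (_≤ t) (sym (≔-new f n z)) z≤t
  injective′ : ∀ {u v} → u < suc n → v < suc n → (f [ n ≔ z ]) u ≡ (f [ n ≔ z ]) v → u ≡ v
  injective′ u< v< eq with m<1+n⇒m<n∨m≡n u< | m<1+n⇒m<n∨m≡n v<
  ... | inj₁ u<n  | inj₁ v<n  = injective u<n v<n (trans (sym (≔-old f z u<n)) (trans eq (≔-old f z v<n)))
  ... | inj₁ u<n  | inj₂ refl = ⊥-elim (z-new u<n (trans (sym (≔-old f z u<n)) (trans eq (≔-new f n z))))
  ... | inj₂ refl | inj₁ v<n  = ⊥-elim (z-new v<n (trans (sym (≔-old f z v<n)) (trans (sym eq) (≔-new f n z))))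
  ... | inj₂ refl | inj₂ refl = refl
  bipartite′ : IsBipartition (attach G w) (side [ n ≔ not (side w) ])
  bipartite′ u v e∈ eq with ∈-++⁻ (edges G) e∈
  ... | inj₁ old with edges-valid old
  ...   | u< , v< = bipartite u v old (trans (sym (≔-old side _ u<)) (trans eq (≔-old side _ v<)))
  bipartite′ u v e∈ eq | inj₂ (here refl) =
    not-¬ refl (trans (sym (≔-old side _ w<)) (trans eq (≔-new side n (not (side w)))))
  separated′ : ∀ {v} → v < suc n → OnSide cut ((side [ n ≔ not (side w) ]) v) ((f [ n ≔ z ]) v)
  separated′ v< with m<1+n⇒m<n∨m≡n v<
  ... | inj₁ v<n  = subst₂ (OnSide cut) (sym (≔-old side _ v<n)) (sym (≔-old f z v<n)) (separated v<n)
  ... | inj₂ refl = subst₂ (OnSide cut) (sym (≔-new side n _)) (sym (≔-new f n z)) z-side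

module Stretch {G f side cut t} (O : IsOrderedLabelling G f side cut t) (a : ℕ) where
  open IsOrderedLabelling O

  stretched : ℕ → ℕ
  stretched v = raiseIfHigh (side v) (a + f v)

  stretched-isOrdered : ∀ {cut′} → a ≤ 1 → a + cut ≤ cut′ → cut′ ≤ suc (a + cut) →
                        IsOrderedLabelling G stretched side cut′ (suc (suc t))
  stretched-isOrdered a≤1 lo hi = record
    { edges-valid = edges-valid
    ; bounded     = λ {v} v< → ≤-trans (raiseIfHigh-≤ (side v) (a + f v)) (s≤s (+-mono-≤ a≤1 (bounded v<)))
    ; injective   = λ u< v< eq → injective u< v< (raiseIfHigh-injective (same-side u< v< eq) eq)
    ; bipartite   = bipartite
    ; separated   = λ v< → raiseIfHigh-onSide lo hi (separated v<)
    }
    where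
    same-side : ∀ {u v} → u < nV G → v < nV G → stretched u ≡ stretched v → side u ≡ side v
    same-side u< v< eq = OnSide-unique (raiseIfHigh-onSide lo hi (separated u<))
                           (subst (OnSide _ _) (sym eq) (raiseIfHigh-onSide lo hi (separated v<)))

  stretched-edgeLabel : ∀ {e} → e ∈ edges G → edgeLabel stretched e ≡ suc (edgeLabel f e)
  stretched-edgeLabel {u , v} e∈ with edges-valid e∈
  ... | u< , v< = raiseIfHigh-edge (separated u<) (separated v<) (bipartite u v e∈)

  stretched-avoids-slot : ∀ {v} → v < nV G → stretched v ≢ suc (a + cut)
  stretched-avoids-slot {v} v< with side v | separated v<
  ... | true  | fv≤cut = <⇒≢ (s≤s (+-monoʳ-≤ a fv≤cut))
  ... | false | cut<fv = ≢-sym (<⇒≢ (s≤s (+-monoʳ-< a cut<fv)))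

module _ {G : Graph} (L : UOL G) where
  open UOL L
  open Stretch isOrderedLabelling

  private
    M = size G
    n = nV G

  attach-folds : ∀ a {w z} → w < n → fold (suc M) ∣ stretched a w - z ∣ ≡ 1 →
                 map (fold (suc M) ∘ edgeLabel (stretched a [ n ≔ z ])) (edges (attach G w))
                 ≡ map suc (map (fold M ∘ edgeLabel label) (edges G)) ++ 1 ∷ []
  attach-folds a {w} {z} w< new-fold = begin
    map h (edges G ++ (w , n) ∷ [])                             ≡⟨ map-++ h (edges G) _ ⟩
    map h (edges G) ++ fold (suc M) ∣ f′ w - f′ n ∣ ∷ []        ≡⟨ cong₂ (λ xs x → xs ++ x ∷ [])
                                                                         (map-cong-local (All.tabulate old-fold)) new-fold′ ⟩
    map (suc ∘ (fold M ∘ edgeLabel label)) (edges G) ++ 1 ∷ []  ≡⟨ cong (_++ 1 ∷ []) (map-∘ (edges G)) ⟩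
    map suc (map (fold M ∘ edgeLabel label) (edges G)) ++ 1 ∷ [] ∎
    where
    open ≡-Reasoning
    f′ = stretched a [ n ≔ z ]
    h = fold (suc M) ∘ edgeLabel f′
    old-fold : ∀ {e} → e ∈ edges G → h e ≡ suc (fold M (edgeLabel label e))
    old-fold {e} e∈ = begin
      fold (suc M) (edgeLabel f′ e)               ≡⟨ cong (fold (suc M)) (edgeLabel-≔ (stretched a) z e∈) ⟩
      fold (suc M) (edgeLabel (stretched a) e)    ≡⟨ cong (fold (suc M)) (stretched-edgeLabel a e∈) ⟩
      fold (suc M) (suc (edgeLabel label e))      ≡⟨ fold-suc (edgeLabel-bounded e∈) ⟩
      suc (fold M (edgeLabel label e))            ∎
    new-fold′ : fold (suc M) ∣ f′ w - f′ n ∣ ≡ 1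
    new-fold′ = trans (cong₂ (λ x y → fold (suc M) ∣ x - y ∣) (≔-old (stretched a) z w<) (≔-new (stretched a) n z))
                      new-fold

  cut≤label : ∀ {c} → AtCut L c → cut ≤ label c
  cut≤label {c} c-at-cut = subst (cut ≤_) (sym c-at-cut) (raiseIfHigh-≥ (side c) cut)

  label≤1+cut : ∀ {c} → AtCut L c → label c ≤ suc cut
  label≤1+cut {c} c-at-cut = subst (_≤ suc cut) (sym c-at-cut) (raiseIfHigh-≤ (side c) cut)

  stretched-at-cut : ∀ a {w c z} → c < n →
                  (stretched a [ n ≔ z ]) c ≡ raiseIfHigh ((side [ n ≔ not (side w) ]) c) (a + label c)
  stretched-at-cut a {w} {c} {z} c< =
    trans (≔-old (stretched a) z c<) (cong (λ b → raiseIfHigh b (a + label c)) (sym (≔-old side (not (side w)) c<)))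

  attach-stretched : ∀ a {w cut′ z} → a ≤ 1 → a + cut ≤ cut′ → cut′ ≤ suc (a + cut) → w < n →
                     z ≤ suc (suc (2 * M)) → OnSide cut′ (not (side w)) z → (∀ {v} → v < n → stretched a v ≢ z) →
                     fold (suc M) ∣ stretched a w - z ∣ ≡ 1 → UOL (attach G w)
  attach-stretched a {w} {cut′} {z} a≤1 lo hi w< z≤ z-side z-new new-fold = record
    { label = stretched a [ n ≔ z ]
    ; side  = side [ n ≔ not (side w) ]
    ; cut   = cut′
    ; isOrderedLabelling = subst (IsOrderedLabelling _ _ _ cut′) (sym (2*size-attach G w))
        (attach-ordered (stretched-isOrdered a a≤1 lo hi) w< z≤ z-side z-new)
    ; folds-unique = subst (λ k → Unique (map (fold k ∘ edgeLabel (stretched a [ n ≔ z ])) (edges (attach G w))))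
        (sym (size-attach G w))
        (subst Unique (sym (attach-folds a w< new-fold))
          (Unique.++⁺ (Unique.map⁺ suc-injective folds-unique) ([] ∷ []) disjoint))
    }
    where
    disjoint : ∀ {x} → ¬ (x ∈ map suc (map (fold M ∘ edgeLabel label) (edges G)) × x ∈ 1 ∷ [])
    disjoint (x∈ , here refl) with ∈-map⁻ suc x∈
    ... | y , y∈ , 1≡1+y = <⇒≢ (folds-positive y∈) (suc-injective 1≡1+y)

attach-at-cut : ∀ {G w} → w < nV G → Σ[ L ∈ UOL G ] AtCut L w → Σ[ L ∈ UOL (attach G w) ] AtCut L (nV G)
attach-at-cut {G} {w} w< (L , w-at-cut) = L′ , new-at-cut
  where
  open UOL L
  open Stretch isOrderedLabelling
  new-label : ∀ b → OnSide (raiseIfHigh b cut) (not b) (suc cut) × ∣ raiseIfHigh b (raiseIfHigh b cut) - suc cut ∣ ≡ 1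
  new-label true  = n<1+n cut , ∣n-1+n∣≡1 cut
  new-label false = ≤-refl , ∣1+n-n∣≡1 cut
  L′ = attach-stretched L 0 z≤n (cut≤label L w-at-cut) (label≤1+cut L w-at-cut) w<
         (m≤n⇒m≤1+n (s≤s (≤-trans (cut≤label L w-at-cut) (bounded w<))))
         (subst (λ c → OnSide c (not (side w)) (suc cut)) (sym w-at-cut) (proj₁ (new-label (side w))))
         (stretched-avoids-slot 0)
         (trans (cong (λ x → fold (suc (size G)) ∣ raiseIfHigh (side w) x - suc cut ∣) w-at-cut)
                (trans (cong (fold (suc (size G))) (proj₂ (new-label (side w)))) (fold-one (size G))))
  new-at-cut : AtCut L′ (nV G)
  new-at-cut = begin
    (stretched 0 [ nV G ≔ suc cut ]) (nV G)                         ≡⟨ ≔-new (stretched 0) (nV G) (suc cut) ⟩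
    suc cut                                                         ≡⟨ flip (side w) ⟨
    raiseIfHigh (not (side w)) (raiseIfHigh (side w) cut)           ≡⟨ cong₂ raiseIfHigh (sym (≔-new side (nV G) (not (side w))))
                                                                                         (sym w-at-cut) ⟩
    raiseIfHigh ((side [ nV G ≔ not (side w) ]) (nV G)) (label w)   ∎
    where
    open ≡-Reasoning
    flip : ∀ b → raiseIfHigh (not b) (raiseIfHigh b cut) ≡ suc cut
    flip true  = refl
    flip false = refl

attach-at-bottom : ∀ {G w c} (L : UOL G) → w < nV G → c < nV G → UOL.side L w ≡ true → UOL.label L w ≡ 0 →
                   AtCut L c → Σ[ L′ ∈ UOL (attach G w) ] AtEnd L′ (nV G) × AtCut L′ c
attach-at-bottom {G} {w} {c} L w< c< w-low w-at-0 c-at-cut = L′ , new-at-end , stretched-at-cut L 0 c<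
  where
  open UOL L
  open Stretch isOrderedLabelling
  top = suc (suc (2 * size G))
  L′ = attach-stretched L 0 z≤n (cut≤label L c-at-cut) (label≤1+cut L c-at-cut) w< ≤-refl
         (subst (λ b → OnSide (label c) (not b) top) (sym w-low) (s≤s (m≤n⇒m≤1+n (bounded c<))))
         (λ v< → <⇒≢ (s≤s (≤-trans (raiseIfHigh-≤ _ _) (s≤s (bounded v<)))))
         (trans (cong (λ x → fold (suc (size G)) ∣ x - top ∣) stretched-w) (fold-top (size G)))
    where
    stretched-w : stretched 0 w ≡ 0
    stretched-w rewrite w-low = w-at-0
  new-at-end : AtEnd L′ (nV G)
  new-at-end = begin
    (stretched 0 [ nV G ≔ top ]) (nV G)                                          ≡⟨ ≔-new (stretched 0) (nV G) top ⟩
    top                                                                          ≡⟨ 2*size-attach G w ⟨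
    outermost (not true) (2 * size (attach G w))                                 ≡⟨ cong (λ b → outermost (not b) _) w-low ⟨
    outermost (not (side w)) (2 * size (attach G w))                             ≡⟨ cong (λ b → outermost b _) (≔-new side (nV G) _) ⟨
    outermost ((side [ nV G ≔ not (side w) ]) (nV G)) (2 * size (attach G w))    ∎
    where open ≡-Reasoning

attach-at-top : ∀ {G w c} (L : UOL G) → w < nV G → c < nV G → UOL.side L w ≡ false → UOL.label L w ≡ 2 * size G →
                AtCut L c → Σ[ L′ ∈ UOL (attach G w) ] AtEnd L′ (nV G) × AtCut L′ c
attach-at-top {G} {w} {c} L w< c< w-high w-at-top c-at-cut = L′ , new-at-end , stretched-at-cut L 1 c<
  where
  open UOL L
  open Stretch isOrderedLabelling
  L′ = attach-stretched L 1 ≤-refl (s≤s (cut≤label L c-at-cut)) (s≤s (label≤1+cut L c-at-cut)) w< z≤n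
         (subst (λ b → OnSide (suc (label c)) (not b) 0) (sym w-high) z≤n)
         (λ {v} _ → raiseIfHigh-suc≢0 (side v) (label v))
         (trans (cong (λ x → fold (suc (size G)) ∣ x - 0 ∣) stretched-w) (fold-top (size G)))
    where
    stretched-w : stretched 1 w ≡ suc (suc (2 * size G))
    stretched-w rewrite w-high = cong (suc ∘ suc) w-at-top
  new-at-end : AtEnd L′ (nV G)
  new-at-end = begin
    (stretched 1 [ nV G ≔ 0 ]) (nV G)                                            ≡⟨ ≔-new (stretched 1) (nV G) 0 ⟩
    outermost (not false) (2 * size (attach G w))                                ≡⟨ cong (λ b → outermost (not b) _) w-high ⟨
    outermost (not (side w)) (2 * size (attach G w))                             ≡⟨ cong (λ b → outermost b _) (≔-new side (nV G) _) ⟨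
    outermost ((side [ nV G ≔ not (side w) ]) (nV G)) (2 * size (attach G w))    ∎
    where open ≡-Reasoning

attach-at-end : ∀ {G w c} → w < nV G → c < nV G → Σ[ L ∈ UOL G ] AtEnd L w × AtCut L c →
                Σ[ L ∈ UOL (attach G w) ] AtEnd L (nV G) × AtCut L c
attach-at-end {w = w} w< c< (L , w-at-end , c-at-cut) with UOL.side L w in w-side
... | true  = attach-at-bottom L w< c< w-side w-at-end c-at-cut
... | false = attach-at-top L w< c< w-side w-at-end c-at-cut

-- Growing the two paths

pathEnd : ℕ → ℕ → ℕ → ℕ
pathEnd r s zero    = r
pathEnd r s (suc k) = s + k

pathEdges-snoc : ∀ r s k → pathEdges r s (suc k) ≡ pathEdges r s k ++ (pathEnd r s k , s + k) ∷ []
pathEdges-snoc r s zero    = cong (λ x → (r , x) ∷ []) (sym (+-identityʳ s))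
pathEdges-snoc r s (suc k) = cong ((r , s) ∷_) (begin
  pathEdges s (suc s) (suc k)                                      ≡⟨ pathEdges-snoc s (suc s) k ⟩
  pathEdges s (suc s) k ++ (pathEnd s (suc s) k , suc s + k) ∷ []  ≡⟨ cong₂ (λ x y → pathEdges s (suc s) k ++ (x , y) ∷ [])
                                                                            (end≡ k) (sym (+-suc s k)) ⟩
  pathEdges s (suc s) k ++ (s + k , s + suc k) ∷ []                ∎)
  where
  open ≡-Reasoning
  end≡ : ∀ k → pathEnd s (suc s) k ≡ s + k
  end≡ zero    = sym (+-identityʳ s)
  end≡ (suc k) = sym (+-suc s k)

graph-≡ : ∀ {G H : Graph} → nV G ≡ nV H → edges G ≡ edges H → G ≡ H
graph-≡ = cong₂ (λ n es → record { nV = n ; edges = es })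

Cmn-suc₂ : ∀ m n₁ n₂ → Cmn m n₁ (suc n₂) ≡ attach (Cmn m n₁ n₂) (pathEnd 0 (m + n₁) n₂)
Cmn-suc₂ m n₁ n₂ = graph-≡ (+-suc (m + n₁) n₂) (begin
  C ++ P₁ ++ pathEdges 0 (m + n₁) (suc n₂)  ≡⟨ cong (λ es → C ++ P₁ ++ es) (pathEdges-snoc 0 (m + n₁) n₂) ⟩
  C ++ P₁ ++ (P₂ ++ e ∷ [])                 ≡⟨ cong (C ++_) (++-assoc P₁ P₂ _) ⟨
  C ++ (P₁ ++ P₂) ++ e ∷ []                 ≡⟨ ++-assoc C (P₁ ++ P₂) _ ⟨
  (C ++ P₁ ++ P₂) ++ e ∷ []                 ∎)
  where
  open ≡-Reasoning
  C = pathEdges 0 1 (m ∸ 1) ++ (m ∸ 1 , 0) ∷ []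
  P₁ = pathEdges 0 m n₁
  P₂ = pathEdges 0 (m + n₁) n₂
  e = (pathEnd 0 (m + n₁) n₂ , m + n₁ + n₂)

Cmn-suc₁ : ∀ m n₁ → Cmn m (suc n₁) 0 ≡ attach (Cmn m n₁ 0) (pathEnd 0 m n₁)
Cmn-suc₁ m n₁ = graph-≡ (trans (+-identityʳ (m + suc n₁)) (trans (+-suc m n₁) (cong suc (sym (+-identityʳ (m + n₁))))))
  (begin
  C ++ pathEdges 0 m (suc n₁) ++ []   ≡⟨ cong (C ++_) (++-identityʳ _) ⟩
  C ++ pathEdges 0 m (suc n₁)         ≡⟨ cong (C ++_) (pathEdges-snoc 0 m n₁) ⟩
  C ++ P₁ ++ e (m + n₁) ∷ []          ≡⟨ cong (λ v → C ++ P₁ ++ e v ∷ []) (+-identityʳ (m + n₁)) ⟨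
  C ++ P₁ ++ e (m + n₁ + 0) ∷ []      ≡⟨ ++-assoc C P₁ _ ⟨
  (C ++ P₁) ++ e (m + n₁ + 0) ∷ []    ≡⟨ cong (λ es → (C ++ es) ++ e (m + n₁ + 0) ∷ []) (++-identityʳ P₁) ⟨
  (C ++ P₁ ++ []) ++ e (m + n₁ + 0) ∷ [] ∎)
  where
  open ≡-Reasoning
  C = pathEdges 0 1 (m ∸ 1) ++ (m ∸ 1 , 0) ∷ []
  P₁ = pathEdges 0 m n₁
  e = λ v → (pathEnd 0 m n₁ , v)

grow-second-path : ∀ {m n₁} → 0 < m → Σ[ L ∈ UOL (Cmn m n₁ 0) ] AtCut L 0 →
                   ∀ n₂ → Σ[ L ∈ UOL (Cmn m n₁ n₂) ] AtCut L (pathEnd 0 (m + n₁) n₂)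
grow-second-path 0<m base zero = base
grow-second-path {m} {n₁} 0<m base (suc n₂) =
  subst (λ G → Σ[ L ∈ UOL G ] AtCut L (m + n₁ + n₂)) (sym (Cmn-suc₂ m n₁ n₂))
    (attach-at-cut (end< n₂) (grow-second-path 0<m base n₂))
  where
  end< : ∀ n₂ → pathEnd 0 (m + n₁) n₂ < m + n₁ + n₂
  end< zero    = subst (0 <_) (sym (+-identityʳ (m + n₁))) (≤-trans 0<m (m≤m+n m n₁))
  end< (suc k) = subst (m + n₁ + k <_) (sym (+-suc (m + n₁) k)) (n<1+n _)

grow-first-path : ∀ {m} → 0 < m → Σ[ L ∈ UOL (Cmn m 1 0) ] AtEnd L (m + 0) × AtCut L 0 →
                  ∀ j → Σ[ L ∈ UOL (Cmn m (suc j) 0) ] AtEnd L (m + j) × AtCut L 0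
grow-first-path 0<m base zero = base
grow-first-path {m} 0<m base (suc j) =
  subst₂ (λ G v → Σ[ L ∈ UOL G ] AtEnd L v × AtCut L 0) (sym (Cmn-suc₁ m (suc j))) (+-identityʳ (m + suc j))
    (attach-at-end end< (≤-trans 0<m (≤-trans (m≤m+n m (suc j)) (m≤m+n _ 0))) (grow-first-path 0<m base j))
  where
  end< : m + j < m + suc j + 0
  end< = subst (m + j <_) (sym (trans (+-identityʳ _) (+-suc m j))) (n<1+n _)

-- Increasing sequences with gaps

∈-iterate⁻ : ∀ {i j n} → i ∈ iterate suc j n → j ≤ i × i < j + n
∈-iterate⁻ {j = j} {suc n} (here refl) = ≤-refl , m<m+n j z<s
∈-iterate⁻ {i} {j} {suc n} (there i∈) with ∈-iterate⁻ i∈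
... | j<i , i< = <⇒≤ j<i , subst (i <_) (sym (+-suc j n)) i<

module Increasing {g : ℕ → ℕ} (g-inc : ∀ i → g i < g (suc i)) where

  g-< : ∀ {i j} → i < j → g i < g j
  g-< {i} {suc j} i<1+j with m<1+n⇒m<n∨m≡n i<1+j
  ... | inj₁ i<j  = <-trans (g-< i<j) (g-inc j)
  ... | inj₂ refl = g-inc i

  g-≤ : ∀ {i j} → i ≤ j → g i ≤ g j
  g-≤ i≤j with m≤n⇒m<n∨m≡n i≤j
  ... | inj₁ i<j  = <⇒≤ (g-< i<j)
  ... | inj₂ refl = ≤-refl

  InGap : ℕ → Set
  InGap x = Σ[ J ∈ ℕ ] g J < x × x < g (suc J)

  gap-∉ : ∀ {x} → InGap x → ∀ is → x ∉ map g is
  gap-∉ (J , gJ<x , x<gJ+1) is x∈ with ∈-map⁻ g x∈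
  ... | i , _ , refl with i ≤? J
  ...   | yes i≤J = <⇒≱ gJ<x (g-≤ i≤J)
  ...   | no  i≰J = <⇒≱ x<gJ+1 (g-≤ (≰⇒> i≰J))

  unique-iterate : ∀ j n → Unique (map g (iterate suc j n))
  unique-iterate j zero    = []
  unique-iterate j (suc n) = All.tabulate (λ x∈ → <⇒≢ (above x∈)) ∷ unique-iterate (suc j) n
    where
    above : ∀ {x} → x ∈ map g (iterate suc (suc j) n) → g j < x
    above x∈ with ∈-map⁻ g x∈
    ... | i , i∈ , refl = g-< (proj₁ (∈-iterate⁻ i∈))

  unique-below-top : ∀ {n top xs} → (∀ {j} → j < n → g j < top) → All (λ x → x < top × InGap x) xs →
                     Unique xs → Unique (map g (iterate suc 0 n) ++ top ∷ xs)
  unique-below-top {n} {top} {xs} below gaps unique-xs =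
    Unique.++⁺ (unique-iterate 0 n) (All.map (λ (x<top , _) → ≢-sym (<⇒≢ x<top)) gaps ∷ unique-xs) disjoint
    where
    disjoint : ∀ {x} → ¬ (x ∈ map g (iterate suc 0 n) × x ∈ top ∷ xs)
    disjoint (x∈ , here refl) with ∈-map⁻ g x∈
    ... | j , j∈ , refl = <-irrefl refl (below (proj₂ (∈-iterate⁻ j∈)))
    disjoint (x∈ , there x∈xs) = gap-∉ (proj₂ (All.lookup gaps x∈xs)) _ x∈

-- Labelling the even cycle

isEven : ℕ → Bool
isEven zero    = true
isEven (suc n) = not (isEven n)

isEven-double : ∀ i → isEven (i + i) ≡ true
isEven-double zero    = refl
isEven-double (suc i) rewrite +-suc i i | not-involutive (isEven (i + i)) = isEven-double i

⌊1+n+n/2⌋≡n : ∀ n → ⌊ suc (n + n) /2⌋ ≡ n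
⌊1+n+n/2⌋≡n n = +-cancelˡ-≡ n _ _ (trans (cong (_+ ⌈ n + n /2⌉) (n≡⌊n+n/2⌋ n)) (⌊n/2⌋+⌈n/2⌉≡n (n + n)))

even-or-odd : ∀ v → Σ[ i ∈ ℕ ] (v ≡ i + i ⊎ v ≡ suc (i + i))
even-or-odd zero = 0 , inj₁ refl
even-or-odd (suc v) with even-or-odd v
... | i , inj₁ refl = i , inj₂ refl
... | i , inj₂ refl = suc i , inj₁ (cong suc (sym (+-suc i i)))

isEven-⌊/2⌋-injective : ∀ {u v} → isEven u ≡ isEven v → ⌊ u /2⌋ ≡ ⌊ v /2⌋ → u ≡ v
isEven-⌊/2⌋-injective {u} {v} same-parity same-half with even-or-odd u | even-or-odd v
... | i , inj₁ refl | j , inj₁ refl =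
  cong (λ k → k + k) (trans (n≡⌊n+n/2⌋ i) (trans same-half (sym (n≡⌊n+n/2⌋ j))))
... | i , inj₂ refl | j , inj₂ refl =
  cong (λ k → suc (k + k)) (trans (sym (⌊1+n+n/2⌋≡n i)) (trans same-half (⌊1+n+n/2⌋≡n j)))
... | i , inj₁ refl | j , inj₂ refl =
  ⊥-elim (not-¬ refl (trans (sym (isEven-double i)) (trans same-parity (cong not (isEven-double j)))))
... | i , inj₂ refl | j , inj₁ refl =
  ⊥-elim (not-¬ refl (trans (sym (isEven-double j)) (trans (sym same-parity) (cong not (isEven-double i)))))

n+n≤1+k+k⇒n≤k : ∀ {n k} → n + n ≤ suc (k + k) → n ≤ k
n+n≤1+k+k⇒n≤k {n} {k} n+n≤ with n ≤? k
... | yes n≤k = n≤k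
... | no  n≰k =
  ⊥-elim (<⇒≱ (s≤s n+n≤) (subst (_≤ n + n) (cong suc (+-suc k k)) (+-mono-≤ (≰⇒> n≰k) (≰⇒> n≰k))))

1+n+n≤k+k⇒n<k : ∀ {n k} → suc (n + n) ≤ k + k → n < k
1+n+n≤k+k⇒n<k {n} {k} 1+n+n≤ with n <? k
... | yes n<k = n<k
... | no  n≮k = ⊥-elim (<⇒≱ 1+n+n≤ (+-mono-≤ (≮⇒≥ n≮k) (≮⇒≥ n≮k)))

cycle : ℕ → Graph
cycle m = record { nV = m ; edges = pathEdges 0 1 (m ∸ 1) ++ (m ∸ 1 , 0) ∷ [] }

Cmn-cycle : ∀ m → Cmn m 0 0 ≡ cycle m
Cmn-cycle m = graph-≡ (trans (+-identityʳ (m + 0)) (+-identityʳ m)) (++-identityʳ _)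

Cmn-pendant : ∀ m → Cmn m 1 0 ≡ attach (cycle m) 0
Cmn-pendant m = graph-≡ (trans (+-identityʳ (m + 1)) (+-comm m 1)) refl

length-pathEdges : ∀ r s k → length (pathEdges r s k) ≡ k
length-pathEdges r s zero    = refl
length-pathEdges r s (suc k) = cong suc (length-pathEdges s (suc s) k)

size-cycle : ∀ n → size (cycle (suc n)) ≡ suc n
size-cycle n = trans (length-++ (pathEdges 0 1 n)) (trans (cong (_+ 1) (length-pathEdges 0 1 n)) (+-comm n 1))

pathEdges-iterate : ∀ j n → pathEdges j (suc j) n ≡ map (λ i → (i , suc i)) (iterate suc j n)
pathEdges-iterate j zero    = refl
pathEdges-iterate j (suc n) = cong ((j , suc j) ∷_) (pathEdges-iterate (suc j) n)

pathEnd-0-1 : ∀ k → pathEnd 0 1 k ≡ k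
pathEnd-0-1 zero    = refl
pathEnd-0-1 (suc k) = refl

module CycleLabelling (K a : ℕ) (d : ℕ → ℕ) (d-mono : ∀ {i j} → i ≤ j → d i ≤ d j) where

  m : ℕ
  m = suc (suc (K + K))

  low : ℕ → ℕ
  low i = a + (K ∸ i)

  high : ℕ → ℕ
  high i = suc (a + K + i + d i)

  cycleLabel : ℕ → ℕ
  cycleLabel v = if isEven v then low ⌊ v /2⌋ else high ⌊ v /2⌋

  pathLabel : ℕ → ℕ
  pathLabel j = suc (j + d ⌊ j /2⌋)

  cycleLabel-even : ∀ i → cycleLabel (i + i) ≡ low i
  cycleLabel-even i rewrite isEven-double i = cong low (sym (n≡⌊n+n/2⌋ i))

  cycleLabel-odd : ∀ i → cycleLabel (suc (i + i)) ≡ high i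
  cycleLabel-odd i rewrite isEven-double i = cong high (⌊1+n+n/2⌋≡n i)

  low≤ : ∀ i → low i ≤ a + K
  low≤ i = +-monoʳ-≤ a (m∸n≤m K i)

  <high : ∀ i → a + K < high i
  <high i = s≤s (≤-trans (m≤m+n (a + K) i) (m≤m+n _ (d i)))

  high-< : ∀ {i j} → i < j → high i < high j
  high-< i<j = s≤s (+-mono-<-≤ (+-monoʳ-< (a + K) i<j) (d-mono (<⇒≤ i<j)))

  high-≤ : ∀ {i j} → i ≤ j → high i ≤ high j
  high-≤ i≤j with m≤n⇒m<n∨m≡n i≤j
  ... | inj₁ i<j  = <⇒≤ (high-< i<j)
  ... | inj₂ refl = ≤-refl

  high-injective : ∀ {i j} → high i ≡ high j → i ≡ j
  high-injective {i} {j} eq with <-cmp i j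
  ... | tri< i<j _ _ = ⊥-elim (<⇒≢ (high-< i<j) eq)
  ... | tri≈ _ i≡j _ = i≡j
  ... | tri> _ _ j<i = ⊥-elim (<⇒≢ (high-< j<i) (sym eq))

  separated : ∀ v → OnSide (a + K) (isEven v) (cycleLabel v)
  separated v with isEven v
  ... | true  = low≤ ⌊ v /2⌋
  ... | false = <high ⌊ v /2⌋

  ⌊/2⌋≤K : ∀ {v} → v < m → ⌊ v /2⌋ ≤ K
  ⌊/2⌋≤K {v} v< = subst (⌊ v /2⌋ ≤_) (⌊1+n+n/2⌋≡n K) (⌊n/2⌋-mono (s≤s⁻¹ v<))

  cycleLabel-≤ : ∀ {v} → v < m → cycleLabel v ≤ high K
  cycleLabel-≤ {v} v< with isEven v
  ... | true  = <⇒≤ (≤-<-trans (low≤ ⌊ v /2⌋) (<high K))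
  ... | false = high-≤ (⌊/2⌋≤K v<)

  cycleLabel-injective : ∀ {u v} → u < m → v < m → cycleLabel u ≡ cycleLabel v → u ≡ v
  cycleLabel-injective {u} {v} u< v< eq = isEven-⌊/2⌋-injective same-parity (same-half (isEven u) same-label)
    where
    same-parity : isEven u ≡ isEven v
    same-parity = OnSide-unique (separated u) (subst (OnSide (a + K) (isEven v)) (sym eq) (separated v))
    same-label : (if isEven u then low ⌊ u /2⌋ else high ⌊ u /2⌋) ≡ (if isEven u then low ⌊ v /2⌋ else high ⌊ v /2⌋)
    same-label = trans eq (cong (λ b → if b then low ⌊ v /2⌋ else high ⌊ v /2⌋) (sym same-parity))
    same-half : ∀ b → (if b then low ⌊ u /2⌋ else high ⌊ u /2⌋) ≡ (if b then low ⌊ v /2⌋ else high ⌊ v /2⌋) →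
                ⌊ u /2⌋ ≡ ⌊ v /2⌋
    same-half true  eq′ = ∸-cancelˡ-≡ (⌊/2⌋≤K u<) (⌊/2⌋≤K v<) (+-cancelˡ-≡ a _ _ eq′)
    same-half false eq′ = high-injective eq′

  pathLabel-increasing : ∀ j → pathLabel j < pathLabel (suc j)
  pathLabel-increasing j = s≤s (s≤s (+-monoʳ-≤ j (d-mono (⌊n/2⌋-mono (n≤1+n j)))))

  pathLabel-double : ∀ i → pathLabel (i + i) ≡ suc (i + i + d i)
  pathLabel-double i = cong (λ k → suc (i + i + d k)) (sym (n≡⌊n+n/2⌋ i))

  pathLabel-double+1 : ∀ i → pathLabel (suc (i + i)) ≡ suc (suc (i + i) + d i)
  pathLabel-double+1 i = cong (λ k → suc (suc (i + i) + d k)) (⌊1+n+n/2⌋≡n i)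

  cycleLabel-path : ∀ {j} → j ≤ K + K → ∣ cycleLabel j - cycleLabel (suc j) ∣ ≡ pathLabel j
  cycleLabel-path {j} j≤ with even-or-odd j
  ... | i , inj₁ refl with m≤n⇒∃[o]m+o≡n (n+n≤1+k+k⇒n≤k (m≤n⇒m≤1+n j≤))
  ...   | e , i+e≡K = begin
    ∣ cycleLabel (i + i) - cycleLabel (suc (i + i)) ∣   ≡⟨ cong₂ ∣_-_∣ (cycleLabel-even i) (cycleLabel-odd i) ⟩
    ∣ a + (K ∸ i) - suc (a + K + i + d i) ∣              ≡⟨ cong (λ k → ∣ a + (k ∸ i) - suc (a + k + i + d i) ∣) (sym i+e≡K) ⟩
    ∣ a + (i + e ∸ i) - suc (a + (i + e) + i + d i) ∣    ≡⟨ cong₂ ∣_-_∣ (cong (a +_) (m+n∸m≡n i e)) (rearrange a i e (d i)) ⟩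
    ∣ a + e - (a + e) + suc (i + i + d i) ∣              ≡⟨ ∣m-m+n∣≡n (a + e) _ ⟩
    suc (i + i + d i)                                    ≡⟨ pathLabel-double i ⟨
    pathLabel (i + i)                                    ∎
    where
    open ≡-Reasoning
    rearrange : ∀ a i e x → suc (a + (i + e) + i + x) ≡ a + e + suc (i + i + x)
    rearrange = solve-∀
  cycleLabel-path {j} j≤ | i , inj₂ refl with m≤n⇒∃[o]m+o≡n (1+n+n≤k+k⇒n<k j≤)
  ...   | e , 1+i+e≡K = begin
    ∣ cycleLabel (suc (i + i)) - cycleLabel (suc (suc (i + i))) ∣   ≡⟨ cong₂ ∣_-_∣ (cycleLabel-odd i) next-even ⟩
    ∣ suc (a + K + i + d i) - a + (K ∸ suc i) ∣                     ≡⟨ cong (λ k → ∣ suc (a + k + i + d i) - a + (k ∸ suc i) ∣)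
                                                                            (sym 1+i+e≡K) ⟩
    ∣ suc (a + (suc i + e) + i + d i) - a + (suc i + e ∸ suc i) ∣   ≡⟨ cong₂ ∣_-_∣ (rearrange a i e (d i))
                                                                                   (cong (a +_) (m+n∸m≡n (suc i) e)) ⟩
    ∣ a + e + suc (suc (i + i) + d i) - a + e ∣                     ≡⟨ ∣m+n-m∣≡n (a + e) _ ⟩
    suc (suc (i + i) + d i)                                        ≡⟨ pathLabel-double+1 i ⟨
    pathLabel (suc (i + i))                                        ∎
    where
    open ≡-Reasoning
    next-even : cycleLabel (suc (suc (i + i))) ≡ low (suc i)
    next-even = trans (cong cycleLabel (sym (+-suc (suc i) i))) (cycleLabel-even (suc i))
    rearrange : ∀ a i e x → suc (a + (suc i + e) + i + x) ≡ a + e + suc (suc (i + i) + x)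
    rearrange = solve-∀

  cycleLabel-closing : ∣ cycleLabel (suc (K + K)) - cycleLabel 0 ∣ ≡ suc (K + d K)
  cycleLabel-closing = begin
    ∣ cycleLabel (suc (K + K)) - a + K ∣   ≡⟨ cong (∣_- a + K ∣) (cycleLabel-odd K) ⟩
    ∣ suc (a + K + K + d K) - a + K ∣      ≡⟨ cong (∣_- a + K ∣) (rearrange a K (d K)) ⟩
    ∣ a + K + suc (K + d K) - a + K ∣      ≡⟨ ∣m+n-m∣≡n (a + K) _ ⟩
    suc (K + d K)                          ∎
    where
    open ≡-Reasoning
    rearrange : ∀ a K x → suc (a + K + K + x) ≡ a + K + suc (K + x)
    rearrange = solve-∀

  cycle-edge : ∀ {e} → e ∈ edges (cycle m) → (Σ[ i ∈ ℕ ] i ≤ K + K × e ≡ (i , suc i)) ⊎ e ≡ (suc (K + K) , 0)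
  cycle-edge {e} e∈ with ∈-++⁻ (pathEdges 0 1 (suc (K + K))) e∈
  ... | inj₂ (here refl) = inj₂ refl
  ... | inj₁ e∈path with ∈-map⁻ (λ i → (i , suc i)) (subst (e ∈_) (pathEdges-iterate 0 (suc (K + K))) e∈path)
  ...   | i , i∈ , refl = inj₁ (i , s≤s⁻¹ (proj₂ (∈-iterate⁻ i∈)) , refl)

  cycle-isOrdered : ∀ {t} → high K ≤ t → IsOrderedLabelling (cycle m) cycleLabel isEven (a + K) t
  cycle-isOrdered high≤t = record
    { edges-valid = edges-valid
    ; bounded     = λ v< → ≤-trans (cycleLabel-≤ v<) high≤t
    ; injective   = cycleLabel-injective
    ; bipartite   = bipartite
    ; separated   = λ {v} _ → separated v
    }
    where
    edges-valid : ∀ {u v} → (u , v) ∈ edges (cycle m) → u < m × v < m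
    edges-valid e∈ with cycle-edge e∈
    ... | inj₁ (i , i≤ , refl) = m≤n⇒m≤1+n (s≤s i≤) , s≤s (s≤s i≤)
    ... | inj₂ refl            = n<1+n _ , z<s
    bipartite : IsBipartition (cycle m) isEven
    bipartite u v e∈ with cycle-edge e∈
    ... | inj₁ (i , _ , refl) = not-¬ refl
    ... | inj₂ refl rewrite isEven-double K = λ ()

  pathLabels : List ℕ
  pathLabels = map pathLabel (iterate suc 0 (K + K))

  cycle-folds : ∀ {M} → (∀ {j} → j < K + K → pathLabel j ≤ M) → fold M (pathLabel (K + K)) ≡ M →
                suc (K + d K) ≤ M → map (fold M ∘ edgeLabel cycleLabel) (edges (cycle m))
                                    ≡ pathLabels ++ M ∷ suc (K + d K) ∷ []
  cycle-folds {M} below last-fold closing≤ = begin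
    map h (pathEdges 0 1 (suc (K + K)) ++ closing ∷ [])
      ≡⟨ cong (λ es → map h (es ++ closing ∷ [])) (pathEdges-snoc 0 1 (K + K)) ⟩
    map h ((P ++ last ∷ []) ++ closing ∷ [])
      ≡⟨ cong (map h) (++-assoc P (last ∷ []) (closing ∷ [])) ⟩
    map h (P ++ last ∷ closing ∷ [])
      ≡⟨ map-++ h P (last ∷ closing ∷ []) ⟩
    map h P ++ h last ∷ h closing ∷ []
      ≡⟨ cong₂ (λ xs x → xs ++ x ∷ h closing ∷ []) path-folds last-folds ⟩
    pathLabels ++ M ∷ h closing ∷ []
      ≡⟨ cong (λ x → pathLabels ++ M ∷ x ∷ []) closing-folds ⟩
    pathLabels ++ M ∷ suc (K + d K) ∷ [] ∎
    where
    open ≡-Reasoning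
    h = fold M ∘ edgeLabel cycleLabel
    P = pathEdges 0 1 (K + K)
    last = (pathEnd 0 1 (K + K) , suc (K + K))
    closing = (suc (K + K) , 0)
    closing-folds : h closing ≡ suc (K + d K)
    closing-folds = trans (cong (fold M) cycleLabel-closing) (fold-≤ closing≤)
    last-folds : h last ≡ M
    last-folds rewrite pathEnd-0-1 (K + K) = trans (cong (fold M) (cycleLabel-path ≤-refl)) last-fold
    path-fold : ∀ {i} → i ∈ iterate suc 0 (K + K) → h (i , suc i) ≡ pathLabel i
    path-fold i∈ with i<K+K ← proj₂ (∈-iterate⁻ i∈) =
      trans (cong (fold M) (cycleLabel-path (<⇒≤ i<K+K))) (fold-≤ (below i<K+K))
    path-folds : map h P ≡ pathLabels
    path-folds = begin
      map h P                                                   ≡⟨ cong (map h) (pathEdges-iterate 0 (K + K)) ⟩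
      map h (map (λ i → (i , suc i)) (iterate suc 0 (K + K)))   ≡⟨ map-∘ (iterate suc 0 (K + K)) ⟨
      map (λ i → h (i , suc i)) (iterate suc 0 (K + K))         ≡⟨ map-cong-local (All.tabulate path-fold) ⟩
      map pathLabel (iterate suc 0 (K + K))                     ∎

  open Increasing pathLabel-increasing using (InGap; unique-below-top)

  LastEdge : ℕ → Set
  LastEdge M = pathLabel (K + K) ≡ M ⊎ pathLabel (K + K) ≡ suc M

  Missing : ℕ → ℕ → Set
  Missing M x = x < M × InGap x

  lastEdge-fold : ∀ {M} → LastEdge M → fold M (pathLabel (K + K)) ≡ M
  lastEdge-fold {M} (inj₁ eq) = trans (cong (fold M) eq) (fold-≤ ≤-refl)
  lastEdge-fold {M} (inj₂ eq) = trans (cong (fold M) eq) (fold-suc-self M)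

  lastEdge-≤ : ∀ {M} → LastEdge M → pathLabel (K + K) ≤ suc M
  lastEdge-≤ (inj₁ eq) = ≤-trans (≤-reflexive eq) (n≤1+n _)
  lastEdge-≤ (inj₂ eq) = ≤-reflexive eq

  high-bound : ∀ {M} → a ≤ 1 → LastEdge M → high K ≤ suc (suc M)
  high-bound {M} a≤1 last = begin
    high K                   ≡⟨ rearrange a K (d K) ⟩
    a + suc (K + K + d K)    ≡⟨ cong (a +_) (pathLabel-double K) ⟨
    a + pathLabel (K + K)    ≤⟨ +-mono-≤ a≤1 (lastEdge-≤ last) ⟩
    suc (suc M)              ∎
    where
    open ≤-Reasoning
    rearrange : ∀ a K x → suc (a + K + K + x) ≡ a + suc (K + K + x)
    rearrange = solve-∀

  pathLabel-below : ∀ {c j} → (∀ {i} → i < K → d i ≤ c) → j < K + K → pathLabel j ≤ c + (K + K)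
  pathLabel-below {c} {j} d≤c j< = subst (pathLabel j ≤_) (+-comm (K + K) c) (+-mono-≤ j< (d≤c ⌊j/2⌋<K))
    where
    ⌊j/2⌋<K : ⌊ j /2⌋ < K
    ⌊j/2⌋<K = subst (suc ⌊ j /2⌋ ≤_) (⌊1+n+n/2⌋≡n K) (⌊n/2⌋-mono (s≤s j<))

  gap-after-odd : ∀ i {x} k → x ≡ suc (suc (suc (i + i))) + d i + k → d i + k < d (suc i) → InGap x
  gap-after-odd i k refl jump = suc (i + i) , below , above
    where
    below : pathLabel (suc (i + i)) < suc (suc (suc (i + i))) + d i + k
    below = subst (_< suc (suc (suc (i + i))) + d i + k) (sym (pathLabel-double+1 i)) (m≤m+n _ k)
    above : suc (suc (suc (i + i))) + d i + k < pathLabel (suc (suc (i + i)))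
    above = begin-strict
      suc (suc (suc (i + i))) + d i + k     ≡⟨ +-assoc (suc (suc (suc (i + i)))) (d i) k ⟩
      suc (suc (suc (i + i))) + (d i + k)   <⟨ +-monoʳ-< (suc (suc (suc (i + i)))) jump ⟩
      suc (suc (suc (i + i))) + d (suc i)   ≡⟨ cong (λ h → suc (suc (suc (i + i)) + d (suc h))) (n≡⌊n+n/2⌋ i) ⟩
      pathLabel (suc (suc (i + i)))         ∎
      where open ≤-Reasoning

  private
    k+n≤2*n : ∀ {k n} → k ≤ n → k + n ≤ 2 * n
    k+n≤2*n {k} {n} k≤n = subst (k + n ≤_) (cong (n +_) (sym (+-identityʳ n))) (+-monoˡ-≤ n k≤n)

  cycle-UOL : a ≤ 1 → LastEdge m → (∀ {i} → i < K → d i ≤ 1) → Missing m (suc (K + d K)) →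
              Σ[ L ∈ UOL (cycle m) ] AtCut L 0
  cycle-UOL a≤1 last d≤1 closing = L , refl
    where
    size≡ = size-cycle (suc (K + K))
    below : ∀ {j} → j < K + K → pathLabel j < m
    below j< = s≤s (pathLabel-below d≤1 j<)
    L : UOL (cycle m)
    L = record
      { label = cycleLabel
      ; side  = isEven
      ; cut   = a + K
      ; isOrderedLabelling = subst (λ k → IsOrderedLabelling (cycle m) cycleLabel isEven (a + K) (2 * k)) (sym size≡)
          (cycle-isOrdered (≤-trans (high-bound a≤1 last) (k+n≤2*n {2} (s≤s (s≤s z≤n)))))
      ; folds-unique = subst (λ k → Unique (map (fold k ∘ edgeLabel cycleLabel) (edges (cycle m)))) (sym size≡)
          (subst Unique (sym (cycle-folds (<⇒≤ ∘ below) (lastEdge-fold last) (<⇒≤ (proj₁ closing))))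
            (unique-below-top below (closing ∷ []) ([] ∷ [])))
      }

  pendantLabel : ℕ → ℕ
  pendantLabel = cycleLabel [ m ≔ 2 * suc m ]

  pendant-folds : (∀ {j} → j < K + K → pathLabel j ≤ suc m) → LastEdge (suc m) → suc (K + d K) ≤ suc m →
                  a + K < suc m → map (fold (suc m) ∘ edgeLabel pendantLabel) (edges (attach (cycle m) 0))
                                  ≡ pathLabels ++ suc m ∷ suc (K + d K) ∷ suc (a + K) ∷ []
  pendant-folds below last closing≤ a+K< = begin
    map h (edges (cycle m) ++ (0 , m) ∷ [])
      ≡⟨ map-++ h (edges (cycle m)) _ ⟩
    map h (edges (cycle m)) ++ h (0 , m) ∷ []
      ≡⟨ cong₂ (λ xs x → xs ++ x ∷ []) (map-cong-local (All.tabulate old-fold)) pendant-fold ⟩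
    map (fold (suc m) ∘ edgeLabel cycleLabel) (edges (cycle m)) ++ suc (a + K) ∷ []
      ≡⟨ cong (_++ suc (a + K) ∷ []) (cycle-folds below (lastEdge-fold last) closing≤) ⟩
    (pathLabels ++ suc m ∷ suc (K + d K) ∷ []) ++ suc (a + K) ∷ []
      ≡⟨ ++-assoc pathLabels _ _ ⟩
    pathLabels ++ suc m ∷ suc (K + d K) ∷ suc (a + K) ∷ [] ∎
    where
    open ≡-Reasoning
    h = fold (suc m) ∘ edgeLabel pendantLabel
    old-fold : ∀ {e} → e ∈ edges (cycle m) → h e ≡ fold (suc m) (edgeLabel cycleLabel e)
    old-fold e∈ = cong (fold (suc m)) (IsOrderedLabelling.edgeLabel-≔ (cycle-isOrdered ≤-refl) cycleLabel (2 * suc m) e∈)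
    pendant-fold : h (0 , m) ≡ suc (a + K)
    pendant-fold = trans (cong₂ (λ x y → fold (suc m) ∣ x - y ∣) (≔-old cycleLabel (2 * suc m) (z<s {suc (K + K)}))
                                                                 (≔-new cycleLabel m (2 * suc m)))
                         (fold-pendant a+K<)

  pendant-UOL : a ≤ 1 → LastEdge (suc m) → (∀ {i} → i < K → d i ≤ 2) →
                Missing (suc m) (suc (K + d K)) → Missing (suc m) (suc (a + K)) → d K ≢ a →
                Σ[ L ∈ UOL (attach (cycle m) 0) ] AtEnd L m × AtCut L 0
  pendant-UOL a≤1 last d≤2 closing pendant dK≢a = L , at-end , at-cut
    where
    top = 2 * suc m
    0<m : 0 < m
    0<m = z<s
    high< : high K < top
    high< = ≤-trans (s≤s (high-bound a≤1 last)) (k+n≤2*n {3} (s≤s (s≤s (s≤s z≤n))))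
    below : ∀ {j} → j < K + K → pathLabel j < suc m
    below j< = s≤s (pathLabel-below d≤2 j<)
    closing≢pendant : suc (K + d K) ≢ suc (a + K)
    closing≢pendant eq = dK≢a (+-cancelʳ-≡ K (d K) a (trans (+-comm (d K) K) (suc-injective eq)))
    side = isEven [ m ≔ false ]
    size≡ : size (attach (cycle m) 0) ≡ suc m
    size≡ = trans (size-attach (cycle m) 0) (cong suc (size-cycle (suc (K + K))))
    L : UOL (attach (cycle m) 0)
    L = record
      { label = pendantLabel
      ; side  = side
      ; cut   = a + K
      ; isOrderedLabelling = subst (IsOrderedLabelling (attach (cycle m) 0) pendantLabel side (a + K)) (cong (2 *_) (sym size≡))
          (attach-ordered (cycle-isOrdered (<⇒≤ high<)) 0<m ≤-refl (<-trans (<high K) high<)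
            (λ v< → <⇒≢ (≤-<-trans (cycleLabel-≤ v<) high<)))
      ; folds-unique = subst (λ k → Unique (map (fold k ∘ edgeLabel pendantLabel) (edges (attach (cycle m) 0)))) (sym size≡)
          (subst Unique (sym (pendant-folds (<⇒≤ ∘ below) last (<⇒≤ (proj₁ closing))
                                            (<-trans (n<1+n (a + K)) (proj₁ pendant))))
            (unique-below-top below (closing ∷ pendant ∷ []) ((closing≢pendant ∷ []) ∷ [] ∷ [])))
      }
    at-end : AtEnd L m
    at-end = trans (≔-new cycleLabel m top)
               (trans (cong (2 *_) (sym size≡))
                      (cong (λ b → outermost b (2 * size (attach (cycle m) 0))) (sym (≔-new isEven m false))))
    at-cut : AtCut L 0
    at-cut = trans (≔-old cycleLabel top 0<m) (cong (λ b → raiseIfHigh b (a + K)) (sym (≔-old isEven false 0<m)))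

-- The base labellings

step : ℕ → ℕ → ℕ
step θ i = if does (θ ≤? i) then 1 else 0

step-hi : ∀ {θ i} → θ ≤ i → step θ i ≡ 1
step-hi {θ} {i} θ≤i rewrite dec-true (θ ≤? i) θ≤i = refl

step-lo : ∀ {θ i} → i < θ → step θ i ≡ 0
step-lo {θ} {i} i<θ rewrite dec-false (θ ≤? i) (<⇒≱ i<θ) = refl

step-≤1 : ∀ θ i → step θ i ≤ 1
step-≤1 θ i with θ ≤? i
... | yes θ≤i = ≤-reflexive (step-hi θ≤i)
... | no  θ≰i = subst (_≤ 1) (sym (step-lo (≰⇒> θ≰i))) z≤n

step-mono : ∀ θ {i j} → i ≤ j → step θ i ≤ step θ j
step-mono θ {i} {j} i≤j with θ ≤? i
... | yes θ≤i = ≤-reflexive (trans (step-hi θ≤i) (sym (step-hi (≤-trans θ≤i i≤j))))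
... | no  θ≰i = subst (_≤ step θ j) (sym (step-lo (≰⇒> θ≰i))) z≤n

-- K = 2r: the jump of d at r + 1 leaves out K + 3, the closing label, and the jump at K makes
-- the last path label 2K + 3, which folds to m.
module CycleEven (q : ℕ) where
  r = suc q
  K = r + r
  d : ℕ → ℕ
  d i = step (suc r) i + step K i
  open CycleLabelling K 0 d (λ i≤j → +-mono-≤ (step-mono (suc r) i≤j) (step-mono K i≤j))

  r<K : r < K
  r<K = m<m+n r z<s

  d[r] : d r ≡ 0
  d[r] = cong₂ _+_ (step-lo (n<1+n r)) (step-lo r<K)

  d[K] : d K ≡ 2
  d[K] = cong₂ _+_ (step-hi r<K) (step-hi {K} ≤-refl)

  base : Σ[ L ∈ UOL (cycle m) ] AtCut L 0
  base = cycle-UOL z≤n last d≤1 (closing< , gap-after-odd r 0 closing≡ jump)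
    where
    last : LastEdge m
    last rewrite pathLabel-double K | d[K] = inj₂ (cong suc (+-comm (K + K) 2))
    d≤1 : ∀ {i} → i < K → d i ≤ 1
    d≤1 {i} i<K = +-mono-≤ (step-≤1 (suc r) i) (≤-reflexive (step-lo i<K))
    closing< : suc (K + d K) < m
    closing< rewrite d[K] = s≤s (s≤s (+-monoʳ-≤ K (≤-trans (s≤s (s≤s z≤n)) r<K)))
    closing≡ : suc (K + d K) ≡ suc (suc (suc (r + r))) + d r + 0
    closing≡ rewrite d[K] | d[r] = e r
      where
      e : ∀ r → suc (r + r + 2) ≡ suc (suc (suc (r + r))) + 0 + 0
      e = solve-∀
    jump : d r + 0 < d (suc r)
    jump rewrite d[r] | step-hi {suc r} {suc r} ≤-refl = z<s

-- K = 2r + 1: the jump of d at r + 1 leaves out K + 2, the closing label; the last path label is m.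
module CycleOdd (r : ℕ) where
  K = suc (r + r)
  d : ℕ → ℕ
  d = step (suc r)
  open CycleLabelling K 0 d (step-mono (suc r))

  d[r] : d r ≡ 0
  d[r] = step-lo (n<1+n r)

  d[K] : d K ≡ 1
  d[K] = step-hi (s≤s (m≤m+n r r))

  base : Σ[ L ∈ UOL (cycle m) ] AtCut L 0
  base = cycle-UOL z≤n last (λ {i} _ → step-≤1 (suc r) i) (closing< , gap-after-odd r 0 closing≡ jump)
    where
    last : LastEdge m
    last rewrite pathLabel-double K | d[K] = inj₁ (cong suc (+-comm (K + K) 1))
    closing< : suc (K + d K) < m
    closing< rewrite d[K] = s≤s (s≤s (+-monoʳ-≤ K (s≤s z≤n)))
    closing≡ : suc (K + d K) ≡ suc (suc (suc (r + r))) + d r + 0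
    closing≡ rewrite d[K] | d[r] = e r
      where
      e : ∀ r → suc (suc (r + r) + 1) ≡ suc (suc (suc (r + r))) + 0 + 0
      e = solve-∀
    jump : d r + 0 < d (suc r)
    jump rewrite d[r] | step-hi {suc r} {suc r} ≤-refl = z<s

-- K = 2r, M = m + 1: the jumps of d at r and r + 1 leave out K + 1, the folded pendant label, and
-- K + 4, the closing label; the jump at K makes the last path label 2K + 4, which folds to M.
module PendantEven (q : ℕ) where
  r = suc q
  K = r + r
  d : ℕ → ℕ
  d i = step r i + step (suc r) i + step K i
  open CycleLabelling K 0 d (λ i≤j → +-mono-≤ (+-mono-≤ (step-mono r i≤j) (step-mono (suc r) i≤j)) (step-mono K i≤j))

  r<K : r < K
  r<K = m<m+n r z<s

  d[q] : d q ≡ 0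
  d[q] = cong₂ _+_ (cong₂ _+_ (step-lo (n<1+n q)) (step-lo (m<n⇒m<1+n (n<1+n q)))) (step-lo (<-trans (n<1+n q) r<K))

  d[r] : d r ≡ 1
  d[r] = cong₂ _+_ (cong₂ _+_ (step-hi {r} ≤-refl) (step-lo (n<1+n r))) (step-lo r<K)

  d[K] : d K ≡ 3
  d[K] = cong₂ _+_ (cong₂ _+_ (step-hi (<⇒≤ r<K)) (step-hi r<K)) (step-hi {K} ≤-refl)

  base : Σ[ L ∈ UOL (attach (cycle m) 0) ] AtEnd L m × AtCut L 0
  base = pendant-UOL z≤n last d≤2 (closing< , gap-after-odd r 0 closing≡ closing-jump)
                     (pendant< , gap-after-odd q 0 pendant≡ pendant-jump) d[K]≢a
    where
    d[K]≢a : d K ≢ 0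
    d[K]≢a rewrite d[K] = λ ()
    last : LastEdge (suc m)
    last rewrite pathLabel-double K | d[K] = inj₂ (cong suc (+-comm (K + K) 3))
    d≤2 : ∀ {i} → i < K → d i ≤ 2
    d≤2 {i} i<K = +-mono-≤ (+-mono-≤ (step-≤1 r i) (step-≤1 (suc r) i)) (≤-reflexive (step-lo i<K))
    closing< : suc (K + d K) < suc m
    closing< rewrite d[K] =
      s≤s (s≤s (subst (_≤ suc (K + K)) (+-comm 3 K) (s≤s (+-monoˡ-≤ K (≤-trans (s≤s (s≤s z≤n)) r<K)))))
    closing≡ : suc (K + d K) ≡ suc (suc (suc (r + r))) + d r + 0
    closing≡ rewrite d[K] | d[r] = e r
      where
      e : ∀ r → suc (r + r + 3) ≡ suc (suc (suc (r + r))) + 1 + 0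
      e = solve-∀
    closing-jump : d r + 0 < d (suc r)
    closing-jump rewrite d[r] | step-hi {r} {suc r} (n≤1+n r) | step-hi {suc r} {suc r} ≤-refl = s≤s (s≤s z≤n)
    pendant< : suc (0 + K) < suc m
    pendant< = s≤s (s≤s (m≤n⇒m≤1+n (m≤m+n K K)))
    pendant≡ : suc (0 + K) ≡ suc (suc (suc (q + q))) + d q + 0
    pendant≡ rewrite d[q] = e q
      where
      e : ∀ q → suc (suc q + suc q) ≡ suc (suc (suc (q + q))) + 0 + 0
      e = solve-∀
    pendant-jump : d q + 0 < d (suc q)
    pendant-jump rewrite d[q] | d[r] = z<s

-- K = 2r + 1, M = m + 1, a = 1: the double jump of d at r + 1 leaves out K + 2, the folded pendant
-- label, and K + 3, the closing label; the last path label is M.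
module PendantOdd (r : ℕ) where
  K = suc (r + r)
  d : ℕ → ℕ
  d i = step (suc r) i + step (suc r) i
  open CycleLabelling K 1 d (λ i≤j → +-mono-≤ (step-mono (suc r) i≤j) (step-mono (suc r) i≤j))

  d[r] : d r ≡ 0
  d[r] = cong₂ _+_ (step-lo (n<1+n r)) (step-lo (n<1+n r))

  d[1+r] : d (suc r) ≡ 2
  d[1+r] = cong₂ _+_ (step-hi {suc r} ≤-refl) (step-hi {suc r} ≤-refl)

  d[K] : d K ≡ 2
  d[K] = cong₂ _+_ (step-hi (s≤s (m≤m+n r r))) (step-hi (s≤s (m≤m+n r r)))

  base : Σ[ L ∈ UOL (attach (cycle m) 0) ] AtEnd L m × AtCut L 0
  base = pendant-UOL ≤-refl last (λ {i} _ → +-mono-≤ (step-≤1 (suc r) i) (step-≤1 (suc r) i))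
                     (closing< , gap-after-odd r 1 closing≡ closing-jump)
                     (pendant< , gap-after-odd r 0 pendant≡ pendant-jump) d[K]≢a
    where
    d[K]≢a : d K ≢ 1
    d[K]≢a rewrite d[K] = λ ()
    last : LastEdge (suc m)
    last rewrite pathLabel-double K | d[K] = inj₁ (cong suc (+-comm (K + K) 2))
    closing< : suc (K + d K) < suc m
    closing< rewrite d[K] = s≤s (s≤s (subst (_≤ suc (K + K)) (+-comm 2 K) (s≤s (+-monoˡ-≤ K (s≤s z≤n)))))
    closing≡ : suc (K + d K) ≡ suc (suc (suc (r + r))) + d r + 1
    closing≡ rewrite d[K] | d[r] = e r
      where
      e : ∀ r → suc (suc (r + r) + 2) ≡ suc (suc (suc (r + r))) + 0 + 1
      e = solve-∀
    closing-jump : d r + 1 < d (suc r)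
    closing-jump rewrite d[r] | d[1+r] = ≤-refl
    pendant< : suc (1 + K) < suc m
    pendant< = s≤s (s≤s (s≤s (m≤m+n K K)))
    pendant≡ : suc (1 + K) ≡ suc (suc (suc (r + r))) + d r + 0
    pendant≡ rewrite d[r] = e r
      where
      e : ∀ r → suc (1 + suc (r + r)) ≡ suc (suc (suc (r + r))) + 0 + 0
      e = solve-∀
    pendant-jump : d r + 0 < d (suc r)
    pendant-jump rewrite d[r] | d[1+r] = z<s

cycle-base : ∀ K → 1 ≤ K → Σ[ L ∈ UOL (cycle (suc (suc (K + K)))) ] AtCut L 0
cycle-base K 1≤K with even-or-odd K
... | zero  , inj₁ refl = ⊥-elim (1+n≰n 1≤K)
... | suc q , inj₁ refl = CycleEven.base q
... | i     , inj₂ refl = CycleOdd.base i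

pendant-base : ∀ K → 1 ≤ K →
               Σ[ L ∈ UOL (attach (cycle (suc (suc (K + K)))) 0) ] AtEnd L (suc (suc (K + K))) × AtCut L 0
pendant-base K 1≤K with even-or-odd K
... | zero  , inj₁ refl = ⊥-elim (1+n≰n 1≤K)
... | suc q , inj₁ refl = PendantEven.base q
... | i     , inj₂ refl = PendantOdd.base i

UOL-Cmn : ∀ K → 1 ≤ K → ∀ n₁ n₂ → UOL (Cmn (suc (suc (K + K))) n₁ n₂)
UOL-Cmn K 1≤K zero    n₂ = proj₁ (grow-second-path {m} {0} z<s cycle-only n₂)
  where
  m = suc (suc (K + K))
  cycle-only = subst (λ G → Σ[ L ∈ UOL G ] AtCut L 0) (sym (Cmn-cycle m)) (cycle-base K 1≤K)
UOL-Cmn K 1≤K (suc j) n₂ = proj₁ (grow-second-path {m} {suc j} z<s (map₂ proj₂ (grow-first-path z<s with-pendant j)) n₂)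
  where
  m = suc (suc (K + K))
  with-pendant = subst₂ (λ G v → Σ[ L ∈ UOL G ] AtEnd L v × AtCut L 0) (sym (Cmn-pendant m)) (sym (+-identityʳ m))
                   (pendant-base K 1≤K)

even-cycle-length : ∀ {m} → 4 ≤ m → 2 ∣ m → Σ[ K ∈ ℕ ] 1 ≤ K × m ≡ suc (suc (K + K))
even-cycle-length (s≤s (s≤s (s≤s (s≤s _)))) (divides (suc (suc k)) refl) = suc k , s≤s z≤n , e k
  where
  e : ∀ k → suc (suc k) * 2 ≡ suc (suc (suc k + suc k))
  e = solve-∀

theorem4 : ∀ (m n₁ n₂ : ℕ) → 4 ≤ m → 2 ∣ m → AdmitsUOL (Cmn m n₁ n₂)
theorem4 m n₁ n₂ 4≤m 2∣m with even-cycle-length 4≤m 2∣m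
... | K , 1≤K , refl = UOL⇒AdmitsUOL (UOL-Cmn K 1≤K n₁ n₂)
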